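{- Let $V$ be a finite ground set, $h: 2^V \to \mathbb{R}$ a monotone submodular set function, and $g_1 \ge g_2 \ge g_3 \ge \dots \ge 0$ a monotonically decreasing sequence of nonnegative weights. Then the sequence function $$f(S) = \sum_{i=1}^{|S|} g_i \cdot \big[h(S_i) - h(S_{i-1})\big]$$ is ordered-submodular.
   Context: For a sequence $S$ of elements of $V$, $S_i$ is the sequence of its first $i$ elements ($S_0$ empty), and $h(S_i)$ denotes $h$ evaluated on the set of elements of $S_i$ (independent of order). For sequences $A, B$, $A\|B$ denotes concatenation and $A\|s$ denotes $A$ with element $s$ appended. A function $f$ on finite sequences of elements of $V$ is ordered-submodular if for all sequences $A$, $B$ and all elements $s, \bar s \in V$: $f(A\|s) - f(A) \ge f(A\|s\|B) - f(A\|\bar s\|B)$. -}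

module Defs where

open import Level using (Level; _⊔_)
open import Data.Nat as ℕ using (ℕ; zero; suc)
open import Data.Fin using (Fin)
open import Data.Fin.Subset using (Subset; ⁅_⁆; _∪_; _∩_; _⊆_) renaming (⊥ to ∅)
open import Data.List using (List; []; _∷_; _++_; [_]; length; take; foldr)
open import Data.Sum using (_⊎_)
open import Algebra.Bundles using (CommutativeRing)

-- An ordered commutative ring (totally ordered, order compatible with + and *).
-- The real numbers are an instance; the paper's statement is the case R = ℝ.
record OrderedCommRing (c ℓ₁ ℓ₂ : Level) : Set (Level.suc (c ⊔ ℓ₁ ⊔ ℓ₂)) where
  field
    commRing : CommutativeRing c ℓ₁
  open CommutativeRing commRing public
  field
    _≤_       : Carrier → Carrier → Set ℓ₂
    ≤-refl    : ∀ {x y} → x ≈ y → x ≤ y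
    ≤-antisym : ∀ {x y} → x ≤ y → y ≤ x → x ≈ y
    ≤-trans   : ∀ {x y z} → x ≤ y → y ≤ z → x ≤ z
    ≤-total   : ∀ x y → (x ≤ y) ⊎ (y ≤ x)
    +-mono    : ∀ {x y} z → x ≤ y → (x + z) ≤ (y + z)
    *-nonneg  : ∀ {x y} → 0# ≤ x → 0# ≤ y → 0# ≤ (x * y)

module _ {c ℓ₁ ℓ₂ : Level} (R : OrderedCommRing c ℓ₁ ℓ₂) where
  open OrderedCommRing R

  Monotone : {n : ℕ} → (Subset n → Carrier) → Set ℓ₂
  Monotone {n} h = ∀ (X Y : Subset n) → X ⊆ Y → h X ≤ h Y

  Submodular : {n : ℕ} → (Subset n → Carrier) → Set ℓ₂
  Submodular {n} h = ∀ (X Y : Subset n) → (h (X ∪ Y) + h (X ∩ Y)) ≤ (h X + h Y)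

  elems : {n : ℕ} → List (Fin n) → Subset n
  elems = foldr (λ x s → ⁅ x ⁆ ∪ s) ∅

  -- f(S) = Σ_{i=1}^{|S|} g_i · [h(S_i) − h(S_{i−1})]   (g indexed from 1; g 0 unused)
  seqFun : {n : ℕ} → (Subset n → Carrier) → (ℕ → Carrier) → List (Fin n) → Carrier
  seqFun h g S = go (length S)
    where
    go : ℕ → Carrier
    go zero    = 0#
    go (suc i) = go i + g (suc i) * (h (elems (take (suc i) S)) - h (elems (take i S)))

  OrderedSubmodular : {n : ℕ} → (List (Fin n) → Carrier) → Set ℓ₂
  OrderedSubmodular {n} f = ∀ (A B : List (Fin n)) (s s̄ : Fin n) →
    (f (A ++ s ∷ B) - f (A ++ s̄ ∷ B)) ≤ (f (A ++ [ s ]) - f A)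

{-# OPTIONS --safe #-}
module Submission where

-- Swapping s for s̄ leaves the prefixes of length ≤ |A| unchanged, so with d_i = h(S_i) − h(S̄_i)
-- the gap between the prefixes of S = A‖s‖B and S̄ = A‖s̄‖B, f(S) − f(S̄) = Σ_{i>|A|} g_i (d_i − d_{i−1})
-- (with d_{|A|} = 0). Monotonicity and submodularity bound every d_i by the marginal gain
-- δ = h(A‖s) − h(A). Summing by parts turns f(S) − f(S̄) into a combination of the d_i with the
-- nonnegative weights g_i − g_{i+1} and g_{|S|}, which add up to g_{|A|+1}; hence
-- f(S) − f(S̄) ≤ g_{|A|+1} δ = f(A‖s) − f(A).

open import Level using (Level)
open import Data.Nat using (ℕ; zero; suc)
open import Data.Fin.Subset using (Subset)
open import Defs

import Data.Nat as ℕ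
import Data.Nat.Properties as ℕ
open import Data.Integer as ℤ using (ℤ; +_; -[1+_]; _⊖_)
import Data.Integer.Properties as ℤ
open import Data.Sign as Sign using (Sign)
open import Data.Fin using (Fin)
open import Data.Fin.Subset using (_⊆_; _∪_; _∩_; ⁅_⁆)
open import Data.Fin.Subset.Properties
  using (x∈p∪q⁻; p⊆p∪q; q⊆p∪q; x∈p∩q⁺; ∪-assoc; ∪-identityˡ; ∪-identityʳ)
open import Data.List using (List; []; _∷_; _++_; [_]; length; take)
open import Data.List.Properties using (length-++; take-all)
open import Data.Maybe using (Maybe; just; nothing)
open import Data.Product using (_,_)
open import Data.Sum using (inj₁; inj₂)
open import Relation.Nullary using (yes; no)
open import Relation.Binary.PropositionalEquality as ≡ using (_≡_)
open import Algebra.Bundles using (CommutativeRing)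
import Algebra.Solver.Ring.AlmostCommutativeRing as ACR

-- Integer rather than ring-element coefficients, because the solver must decide coefficient equality.
module IntegerCoefficientSolver {c ℓ : Level} (CR : CommutativeRing c ℓ) where
  open CommutativeRing CR
  open import Algebra.Properties.Ring ring
    using (-‿involutive; -0#≈0#; -‿distribˡ-*; -‿distribʳ-*; -‿+-comm)
  open import Algebra.Properties.Semiring.Mult semiring using (_×_; ×-homo-+; ×1-homo-*)
  open import Relation.Binary.Reasoning.Setoid setoid

  ⟦_⟧ : ℤ → Carrier
  ⟦ + n ⟧     = n × 1#
  ⟦ -[1+ n ] ⟧ = - (suc n × 1#)

  ⊖-homo : ∀ m n → ⟦ m ⊖ n ⟧ ≈ m × 1# - n × 1#
  ⊖-homo zero    zero    = sym (trans (+-congˡ -0#≈0#) (+-identityʳ 0#))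
  ⊖-homo zero    (suc n) = sym (+-identityˡ _)
  ⊖-homo (suc m) zero    = sym (trans (+-congˡ -0#≈0#) (+-identityʳ _))
  ⊖-homo (suc m) (suc n) = begin
    ⟦ suc m ⊖ suc n ⟧                        ≡⟨ ≡.cong ⟦_⟧ (ℤ.[1+m]⊖[1+n]≡m⊖n m n) ⟩
    ⟦ m ⊖ n ⟧                                ≈⟨ ⊖-homo m n ⟩
    m × 1# - n × 1#                          ≈⟨ +-identityˡ _ ⟨
    0# + (m × 1# - n × 1#)                   ≈⟨ +-congʳ (-‿inverseʳ 1#) ⟨
    (1# - 1#) + (m × 1# - n × 1#)            ≈⟨ +-assoc 1# (- 1#) _ ⟩
    1# + (- 1# + (m × 1# - n × 1#))          ≈⟨ +-congˡ (+-assoc (- 1#) _ _) ⟨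
    1# + ((- 1# + m × 1#) - n × 1#)          ≈⟨ +-congˡ (+-congʳ (+-comm (- 1#) _)) ⟩
    1# + ((m × 1# - 1#) - n × 1#)            ≈⟨ +-congˡ (+-assoc _ _ _) ⟩
    1# + (m × 1# + (- 1# - n × 1#))          ≈⟨ +-assoc _ _ _ ⟨
    (1# + m × 1#) + (- 1# - n × 1#)          ≈⟨ +-congˡ (-‿+-comm 1# (n × 1#)) ⟩
    (1# + m × 1#) - (1# + n × 1#)            ∎

  +-homo : ∀ i j → ⟦ i ℤ.+ j ⟧ ≈ ⟦ i ⟧ + ⟦ j ⟧
  +-homo (+ m)     (+ n)     = ×-homo-+ 1# m n
  +-homo (+ m)     -[1+ n ]  = ⊖-homo m (suc n)
  +-homo -[1+ m ]  (+ n)     = trans (⊖-homo n (suc m)) (+-comm _ _)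
  +-homo -[1+ m ]  -[1+ n ]  = begin
    - ((suc (suc (m ℕ.+ n))) × 1#)           ≡⟨ ≡.cong (λ k → - (k × 1#)) (≡.sym (ℕ.+-suc (suc m) n)) ⟩
    - ((suc m ℕ.+ suc n) × 1#)               ≈⟨ -‿cong (×-homo-+ 1# (suc m) (suc n)) ⟩
    - (suc m × 1# + suc n × 1#)              ≈⟨ -‿+-comm _ _ ⟨
    - (suc m × 1#) - suc n × 1#              ∎

  signed : Sign → Carrier → Carrier
  signed Sign.+ x = x
  signed Sign.- x = - x

  signed-cong : ∀ s {x y} → x ≈ y → signed s x ≈ signed s y
  signed-cong Sign.+ x≈y = x≈y
  signed-cong Sign.- x≈y = -‿cong x≈y

  signed-* : ∀ s t x y → signed (s Sign.* t) (x * y) ≈ signed s x * signed t y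
  signed-* Sign.+ Sign.+ x y = refl
  signed-* Sign.+ Sign.- x y = -‿distribʳ-* x y
  signed-* Sign.- Sign.+ x y = -‿distribˡ-* x y
  signed-* Sign.- Sign.- x y =
    trans (sym (-‿involutive _)) (trans (-‿cong (-‿distribʳ-* x y)) (-‿distribˡ-* x (- y)))

  ⟦◃⟧ : ∀ s n → ⟦ s ℤ.◃ n ⟧ ≈ signed s (n × 1#)
  ⟦◃⟧ Sign.+ zero    = refl
  ⟦◃⟧ Sign.- zero    = sym -0#≈0#
  ⟦◃⟧ Sign.+ (suc n) = refl
  ⟦◃⟧ Sign.- (suc n) = refl

  ⟦⟧-sign-abs : ∀ i → ⟦ i ⟧ ≈ signed (ℤ.sign i) (ℤ.∣ i ∣ × 1#)
  ⟦⟧-sign-abs (+ n)     = refl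
  ⟦⟧-sign-abs -[1+ n ] = refl

  *-homo : ∀ i j → ⟦ i ℤ.* j ⟧ ≈ ⟦ i ⟧ * ⟦ j ⟧
  *-homo i j = begin
    ⟦ s ℤ.◃ (ℤ.∣ i ∣ ℕ.* ℤ.∣ j ∣) ⟧                                 ≈⟨ ⟦◃⟧ s (ℤ.∣ i ∣ ℕ.* ℤ.∣ j ∣) ⟩
    signed s ((ℤ.∣ i ∣ ℕ.* ℤ.∣ j ∣) × 1#)                          ≈⟨ signed-cong s (×1-homo-* ℤ.∣ i ∣ ℤ.∣ j ∣) ⟩
    signed s ((ℤ.∣ i ∣ × 1#) * (ℤ.∣ j ∣ × 1#))                     ≈⟨ signed-* (ℤ.sign i) (ℤ.sign j) _ _ ⟩
    signed (ℤ.sign i) (ℤ.∣ i ∣ × 1#) * signed (ℤ.sign j) (ℤ.∣ j ∣ × 1#) ≈⟨ *-cong (⟦⟧-sign-abs i) (⟦⟧-sign-abs j) ⟨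
    ⟦ i ⟧ * ⟦ j ⟧                                                   ∎
    where
    s : Sign
    s = ℤ.sign i Sign.* ℤ.sign j

  -‿homo : ∀ i → ⟦ ℤ.- i ⟧ ≈ - ⟦ i ⟧
  -‿homo (+ zero)   = sym -0#≈0#
  -‿homo (+ suc n)  = refl
  -‿homo -[1+ n ]  = sym (-‿involutive _)

  ℤ⟶R : ℤ.+-*-rawRing ACR.-Raw-AlmostCommutative⟶ ACR.fromCommutativeRing CR
  ℤ⟶R = record
    { ⟦_⟧ = ⟦_⟧ ; +-homo = +-homo ; *-homo = *-homo ; -‿homo = -‿homo
    ; 0-homo = refl ; 1-homo = +-identityʳ 1# }

  ⟦⟧-≟ : ∀ i j → Maybe (⟦ i ⟧ ≈ ⟦ j ⟧)
  ⟦⟧-≟ i j with i ℤ.≟ j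
  ... | yes ≡.refl = just refl
  ... | no _       = nothing

  open import Algebra.Solver.Ring ℤ.+-*-rawRing (ACR.fromCommutativeRing CR) ℤ⟶R ⟦⟧-≟
    public using (solve; _:=_; _:+_; _:-_; :-_; _:*_; con)

module OrderedCommRingProperties {c ℓ₁ ℓ₂ : Level} (R : OrderedCommRing c ℓ₁ ℓ₂) where
  open OrderedCommRing R
  open IntegerCoefficientSolver commRing

  ≤-resp-≈ : ∀ {x x′ y y′} → x ≈ x′ → y ≈ y′ → x ≤ y → x′ ≤ y′
  ≤-resp-≈ x≈x′ y≈y′ x≤y = ≤-trans (≤-refl (sym x≈x′)) (≤-trans x≤y (≤-refl y≈y′))

  +-monoʳ-≤ : ∀ {x y} z → x ≤ y → (z + x) ≤ (z + y)
  +-monoʳ-≤ {x} {y} z x≤y = ≤-resp-≈ (+-comm x z) (+-comm y z) (+-mono z x≤y)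

  +-mono-≤ : ∀ {x y u v} → x ≤ y → u ≤ v → (x + u) ≤ (y + v)
  +-mono-≤ {y = y} {u} x≤y u≤v = ≤-trans (+-mono u x≤y) (+-monoʳ-≤ y u≤v)

  x≤x+y : ∀ {x y} → 0# ≤ y → x ≤ (x + y)
  x≤x+y {x} 0≤y = ≤-resp-≈ (+-identityʳ x) refl (+-monoʳ-≤ x 0≤y)

  x≤y⇒0≤y-x : ∀ {x y} → x ≤ y → 0# ≤ (y - x)
  x≤y⇒0≤y-x {x} x≤y = ≤-resp-≈ (-‿inverseʳ x) refl (+-mono (- x) x≤y)

  0≤y-x⇒x≤y : ∀ {x y} → 0# ≤ (y - x) → x ≤ y
  0≤y-x⇒x≤y {x} {y} 0≤y-x =
    ≤-resp-≈ (+-identityˡ x) (solve 2 (λ x y → (y :- x) :+ x := y) refl x y) (+-mono x 0≤y-x)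

  *-monoˡ-≤ : ∀ {x y z} → 0# ≤ z → x ≤ y → (x * z) ≤ (y * z)
  *-monoˡ-≤ {x} {y} {z} 0≤z x≤y = 0≤y-x⇒x≤y (≤-resp-≈ refl
    (solve 3 (λ x y z → (y :- x) :* z := y :* z :- x :* z) refl x y z)
    (*-nonneg (x≤y⇒0≤y-x x≤y) 0≤z))

  +≤+⇒-≤- : ∀ {x y u v} → (x + v) ≤ (u + y) → (x - y) ≤ (u - v)
  +≤+⇒-≤- {x} {y} {u} {v} x+v≤u+y = ≤-resp-≈
    (solve 4 (λ x y u v → (x :+ v) :+ (:- y :- v) := x :- y) refl x y u v)
    (solve 4 (λ x y u v → (u :+ y) :+ (:- y :- v) := u :- v) refl x y u v)
    (+-mono (- y - v) x+v≤u+y)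

  -- Abel summation: E j = w j * e j + Σ_{i<j} (w i - w (suc i)) * e i, a combination of
  -- the e i with nonnegative coefficients summing to w 0.
  summation-by-parts-≤ : (w e E : ℕ → Carrier) (δ : Carrier) →
    (∀ j → w (suc j) ≤ w j) → (∀ j → 0# ≤ w j) → (∀ j → e j ≤ δ) →
    E 0 ≈ w 0 * e 0 → (∀ j → E (suc j) ≈ E j + w (suc j) * (e (suc j) - e j)) →
    ∀ j → E j ≤ (w 0 * δ)
  summation-by-parts-≤ w e E δ w-antitone w-nonneg e≤δ E-zero E-suc j =
    ≤-trans (x≤x+y (*-nonneg (w-nonneg j) (slack j))) (invariant j)
    where
    slack : ∀ j → 0# ≤ (δ - e j)
    slack j = x≤y⇒0≤y-x (e≤δ j)

    invariant : ∀ j → (E j + w j * (δ - e j)) ≤ (w 0 * δ)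
    invariant zero = ≤-refl (trans (+-congʳ E-zero)
      (solve 3 (λ w e δ → w :* e :+ w :* (δ :- e) := w :* δ) refl (w 0) (e 0) δ))
    invariant (suc j) = ≤-trans
      (≤-resp-≈ (sym (trans (+-congʳ (E-suc j)) (telescope (E j) (w (suc j)) (e (suc j)) (e j)))) refl
        (+-monoʳ-≤ (E j) (*-monoˡ-≤ (slack j) (w-antitone j))))
      (invariant j)
      where
      telescope : ∀ E w e′ e → (E + w * (e′ - e)) + w * (δ - e′) ≈ E + w * (δ - e)
      telescope = solve 5 (λ δ E w e′ e → (E :+ w :* (e′ :- e)) :+ w :* (δ :- e′) := E :+ w :* (δ :- e)) refl δ

module _ {a} {A : Set a} where

  take-++ˡ : ∀ i (xs ys : List A) → i ℕ.≤ length xs → take i (xs ++ ys) ≡ take i xs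
  take-++ˡ zero    xs       ys _          = ≡.refl
  take-++ˡ (suc i) (x ∷ xs) ys (ℕ.s≤s i≤) = ≡.cong (x ∷_) (take-++ˡ i xs ys i≤)

  take-+-length-++ : ∀ i (xs ys : List A) → take (i ℕ.+ length xs) (xs ++ ys) ≡ xs ++ take i ys
  take-+-length-++ i []       ys rewrite ℕ.+-identityʳ i = ≡.refl
  take-+-length-++ i (x ∷ xs) ys rewrite ℕ.+-suc i (length xs) = ≡.cong (x ∷_) (take-+-length-++ i xs ys)

module _ {c ℓ₁ ℓ₂ : Level} (R : OrderedCommRing c ℓ₁ ℓ₂) where
  open OrderedCommRing R
  open OrderedCommRingProperties R
  open IntegerCoefficientSolver commRing

  submodular-exchange : ∀ {n} {h : Subset n → Carrier} → Monotone R h → Submodular R h →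
    ∀ a t u c → (h (a ∪ (t ∪ c)) + h a) ≤ (h (a ∪ t) + h (a ∪ (u ∪ c)))
  submodular-exchange {n} {h} mono subm a t u c = ≤-trans
    (+-mono-≤ (mono _ _ a∪[t∪c]⊆X∪Y) (mono _ _ a⊆X∩Y))
    (≤-trans (subm X Y) (+-monoʳ-≤ (h X) (mono _ _ Y⊆a∪[u∪c])))
    where
    X Y : Subset n
    X = a ∪ t
    Y = a ∪ c

    a∪[t∪c]⊆X∪Y : a ∪ (t ∪ c) ⊆ X ∪ Y
    a∪[t∪c]⊆X∪Y x∈ with x∈p∪q⁻ a (t ∪ c) x∈
    ... | inj₁ x∈a = p⊆p∪q Y (p⊆p∪q t x∈a)
    ... | inj₂ x∈t∪c with x∈p∪q⁻ t c x∈t∪c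
    ...   | inj₁ x∈t = p⊆p∪q Y (q⊆p∪q a t x∈t)
    ...   | inj₂ x∈c = q⊆p∪q X Y (q⊆p∪q a c x∈c)

    a⊆X∩Y : a ⊆ X ∩ Y
    a⊆X∩Y x∈a = x∈p∩q⁺ (p⊆p∪q t x∈a , p⊆p∪q c x∈a)

    Y⊆a∪[u∪c] : Y ⊆ a ∪ (u ∪ c)
    Y⊆a∪[u∪c] x∈ with x∈p∪q⁻ a c x∈
    ... | inj₁ x∈a = p⊆p∪q (u ∪ c) x∈a
    ... | inj₂ x∈c = q⊆p∪q a (u ∪ c) (q⊆p∪q u c x∈c)

  elems-++ : ∀ {n} (xs ys : List (Fin n)) → elems R (xs ++ ys) ≡ elems R xs ∪ elems R ys
  elems-++ []       ys = ≡.sym (∪-identityˡ (elems R ys))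
  elems-++ (x ∷ xs) ys = ≡.trans (≡.cong (⁅ x ⁆ ∪_) (elems-++ xs ys)) (≡.sym (∪-assoc ⁅ x ⁆ _ _))

  module _ {n : ℕ} (h : Subset n → Carrier) where

    ĥ : List (Fin n) → Carrier
    ĥ xs = h (elems R xs)

    ĥ-exchange : Monotone R h → Submodular R h → ∀ A s s̄ C →
      (ĥ (A ++ s ∷ C) - ĥ (A ++ s̄ ∷ C)) ≤ (ĥ (A ++ [ s ]) - ĥ A)
    ĥ-exchange mono subm A s s̄ C
      rewrite elems-++ A (s ∷ C) | elems-++ A (s̄ ∷ C) | elems-++ A [ s ] | ∪-identityʳ ⁅ s ⁆ =
      +≤+⇒-≤- (submodular-exchange mono subm (elems R A) ⁅ s ⁆ ⁅ s̄ ⁆ (elems R C))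

    module _ (g : ℕ → Carrier) where

      seqFunPrefix : List (Fin n) → ℕ → Carrier
      seqFunPrefix S zero    = 0#
      seqFunPrefix S (suc i) = seqFunPrefix S i + g (suc i) * (ĥ (take (suc i) S) - ĥ (take i S))

      seqFunPrefix-unique : ∀ S (F : ℕ → Carrier) → F 0 ≡ 0# →
        (∀ i → F (suc i) ≡ F i + g (suc i) * (ĥ (take (suc i) S) - ĥ (take i S))) →
        ∀ i → F i ≡ seqFunPrefix S i
      seqFunPrefix-unique S F F-zero F-suc zero    = F-zero
      seqFunPrefix-unique S F F-zero F-suc (suc i) =
        ≡.trans (F-suc i) (≡.cong (_+ _) (seqFunPrefix-unique S F F-zero F-suc i))

      -- Abstracting length S makes seqFun's local recursion a solvable instance of F.
      seqFun≡seqFunPrefix : ∀ S → seqFun R h g S ≡ seqFunPrefix S (length S)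
      seqFun≡seqFunPrefix S with length S | seqFunPrefix-unique S _ ≡.refl (λ _ → ≡.refl)
      ... | m | go≡ = go≡ m

      seqFunPrefix-++ : ∀ i xs ys → i ℕ.≤ length xs → seqFunPrefix (xs ++ ys) i ≡ seqFunPrefix xs i
      seqFunPrefix-++ zero    xs ys _  = ≡.refl
      seqFunPrefix-++ (suc i) xs ys i< rewrite seqFunPrefix-++ i xs ys (ℕ.<⇒≤ i<)
        | take-++ˡ (suc i) xs ys i< | take-++ˡ i xs ys (ℕ.<⇒≤ i<) = ≡.refl

      seqFun-∷ʳ : ∀ xs x →
        seqFun R h g (xs ++ [ x ]) ≡ seqFun R h g xs + g (suc (length xs)) * (ĥ (xs ++ [ x ]) - ĥ xs)
      seqFun-∷ʳ xs x =
        ≡.trans (seqFun≡seqFunPrefix (xs ++ [ x ]))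
          (≡.trans (≡.cong (seqFunPrefix (xs ++ [ x ])) length-xs∷ʳx) last-step)
        where
        m : ℕ
        m = length xs

        length-xs∷ʳx : length (xs ++ [ x ]) ≡ suc m
        length-xs∷ʳx = ≡.trans (length-++ xs) (ℕ.+-comm m 1)

        last-step : seqFunPrefix (xs ++ [ x ]) (suc m) ≡ seqFun R h g xs + g (suc m) * (ĥ (xs ++ [ x ]) - ĥ xs)
        last-step rewrite seqFunPrefix-++ m xs [ x ] ℕ.≤-refl | take-+-length-++ 1 xs [ x ]
          | take-++ˡ m xs [ x ] ℕ.≤-refl | take-all m xs ℕ.≤-refl =
          ≡.cong (_+ _) (≡.sym (seqFun≡seqFunPrefix xs))

      ĥ-gap : List (Fin n) → List (Fin n) → ℕ → Carrier
      ĥ-gap S T i = ĥ (take i S) - ĥ (take i T)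

      seqFunPrefix-gap : List (Fin n) → List (Fin n) → ℕ → Carrier
      seqFunPrefix-gap S T i = seqFunPrefix S i - seqFunPrefix T i

      seqFunPrefix-gap-suc : ∀ S T i →
        seqFunPrefix-gap S T (suc i) ≈ seqFunPrefix-gap S T i + g (suc i) * (ĥ-gap S T (suc i) - ĥ-gap S T i)
      seqFunPrefix-gap-suc S T i = solve 7
        (λ p q G x y x′ y′ → (p :+ G :* (x :- y)) :- (q :+ G :* (x′ :- y′))
                          := (p :- q) :+ G :* ((x :- x′) :- (y :- y′)))
        refl (seqFunPrefix S i) (seqFunPrefix T i) (g (suc i))
        (ĥ (take (suc i) S)) (ĥ (take i S)) (ĥ (take (suc i) T)) (ĥ (take i T))

      seqFun-swap-≤ : Monotone R h → Submodular R h →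
        (∀ i → g (suc (suc i)) ≤ g (suc i)) → (∀ i → 0# ≤ g (suc i)) → ∀ A B s s̄ →
        (seqFun R h g (A ++ s ∷ B) - seqFun R h g (A ++ s̄ ∷ B)) ≤ (g (suc (length A)) * (ĥ (A ++ [ s ]) - ĥ A))
      seqFun-swap-≤ mono subm g-antitone g-nonneg A B s s̄ =
        ≤-resp-≈ (reflexive (≡.sym seqFun-gap≡)) refl
          (summation-by-parts-≤ w e E δ (λ j → g-antitone (j ℕ.+ m)) (λ j → g-nonneg (j ℕ.+ m))
            e≤δ E-zero (λ j → seqFunPrefix-gap-suc S T (suc j ℕ.+ m)) (length B))
        where
        m : ℕ
        m = length A

        S T : List (Fin n)
        S = A ++ s ∷ B
        T = A ++ s̄ ∷ B

        w e E : ℕ → Carrier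
        w j = g (suc j ℕ.+ m)
        e j = ĥ-gap S T (suc j ℕ.+ m)
        E j = seqFunPrefix-gap S T (suc j ℕ.+ m)

        δ : Carrier
        δ = ĥ (A ++ [ s ]) - ĥ A

        e≤δ : ∀ j → e j ≤ δ
        e≤δ j rewrite take-+-length-++ (suc j) A (s ∷ B) | take-+-length-++ (suc j) A (s̄ ∷ B) =
          ĥ-exchange mono subm A s s̄ (take j B)

        prefix-gap-≈0 : seqFunPrefix-gap S T m ≈ 0#
        prefix-gap-≈0 rewrite seqFunPrefix-++ m A (s ∷ B) ℕ.≤-refl | seqFunPrefix-++ m A (s̄ ∷ B) ℕ.≤-refl =
          -‿inverseʳ _

        ĥ-gap-≈0 : ĥ-gap S T m ≈ 0#
        ĥ-gap-≈0 rewrite take-++ˡ m A (s ∷ B) ℕ.≤-refl | take-++ˡ m A (s̄ ∷ B) ℕ.≤-refl = -‿inverseʳ _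

        E-zero : E 0 ≈ w 0 * e 0
        E-zero = trans (seqFunPrefix-gap-suc S T m)
          (trans (+-cong prefix-gap-≈0 (*-congˡ (+-congˡ (-‿cong ĥ-gap-≈0))))
            (solve 2 (λ G x → con ℤ.0ℤ :+ G :* (x :- con ℤ.0ℤ) := G :* x) refl (w 0) (e 0)))

        seqFun-gap≡ : seqFun R h g S - seqFun R h g T ≡ E (length B)
        seqFun-gap≡ rewrite seqFun≡seqFunPrefix S | seqFun≡seqFunPrefix T
          | length-++ A {s ∷ B} | length-++ A {s̄ ∷ B} | ℕ.+-comm m (suc (length B)) = ≡.refl

lemma3 : {c ℓ₁ ℓ₂ : Level} (R : OrderedCommRing c ℓ₁ ℓ₂) (n : ℕ)
    (h : Subset n → OrderedCommRing.Carrier R) (g : ℕ → OrderedCommRing.Carrier R) →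
    Monotone R h → Submodular R h →
    (∀ i → OrderedCommRing._≤_ R (g (suc (suc i))) (g (suc i))) →
    (∀ i → OrderedCommRing._≤_ R (OrderedCommRing.0# R) (g (suc i))) →
    OrderedSubmodular R (seqFun R h g)
lemma3 R n h g mono subm g-antitone g-nonneg A B s s̄ =
  ≤-resp-≈ refl (sym marginal-gain) (seqFun-swap-≤ R h g mono subm g-antitone g-nonneg A B s s̄)
  where
  open OrderedCommRing R
  open OrderedCommRingProperties R using (≤-resp-≈)
  open IntegerCoefficientSolver commRing using (solve; _:=_; _:+_; _:-_)

  marginal-gain : (seqFun R h g (A ++ [ s ]) - seqFun R h g A)
                  ≈ g (suc (length A)) * (ĥ R h (A ++ [ s ]) - ĥ R h A)
  marginal-gain = trans (+-congʳ (reflexive (seqFun-∷ʳ R h g A s)))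
    (solve 2 (λ p x → (p :+ x) :- p := x) refl _ _)
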